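{- Let $(A,\mathbf{C}^t_A)$ be a tangled closure algebra with induced closure operator $\mathbf{C}_A$ and interior operator $\mathbf{I}_A$, and let $\alpha\in A$ be open, i.e. $\mathbf{I}_A\alpha=\alpha$. Then the relativisation $(A_\alpha,\mathbf{C}^t_\alpha)$ is a tangled closure algebra whose induced closure operator is $\mathbf{C}_\alpha$.
   Context: A Boolean algebra $A$ has operations $\land,\lor,-,0,1$; $a\Rightarrow b=-a\lor b$. A closure operator on $A$ is $\mathbf{C}:A\to A$ with $\mathbf{C}(a\lor b)=\mathbf{C}a\lor\mathbf{C}b$, $\mathbf{C}0=0$, $a\leq\mathbf{C}a=\mathbf{C}\mathbf{C}a$; interior $\mathbf{I}a=-\mathbf{C}-a$. $\mathcal{P}_{fin}A$ is the set of finite non-empty subsets of $A$. For $\mathbf{C}^t:\mathcal{P}_{fin}A\to A$, the induced $\mathbf{C}a=\mathbf{C}^t\{a\}$, $\mathbf{I}a=-\mathbf{C}^t\{ -a\}$; $(A,\mathbf{C}^t)$ is a tangled closure algebra if $\mathbf{C}$ is a closure operator and for all $\varGamma\in\mathcal{P}_{fin}A$, $a\in A$: (Fix) $\mathbf{C}^t\varGamma\leq\bigwedge_{\gamma\in\varGamma}\mathbf{C}(\gamma\land\mathbf{C}^t\varGamma)$; (Ind) $\mathbf{I}(a\Rightarrow\bigwedge_{\gamma\in\varGamma}\mathbf{C}(\gamma\land a))\land a\leq\mathbf{C}^t\varGamma$. Relativisation: for $\alpha\in A$, $A_\alpha=\{b\in A:b\leq\alpha\}$ is the Boolean algebra with the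 same joins and meets as $A$, top $\alpha$, and complement $b\mapsto\alpha\land-b$ (so its implication is $b\Rightarrow_\alpha c=(\alpha\land-b)\lor c$); $\mathbf{C}_\alpha b=\alpha\land\mathbf{C}_Ab$ for $b\in A_\alpha$; and $\mathbf{C}^t_\alpha\varGamma=\alpha\land\mathbf{C}^t_A\varGamma$ for finite non-empty $\varGamma\subseteq A_\alpha$. -}

module Defs where

open import Level using (Level; _⊔_)
open import Data.Product using (Σ; _,_; proj₁; proj₂; _×_)
open import Data.List.NonEmpty using (List⁺; toList; foldr₁; [_]) renaming (map to map⁺)
open import Data.List.Relation.Binary.Pointwise using (Pointwise)
open import Relation.Binary.Core using (Rel)
open import Algebra.Core using (Op₁; Op₂)
open import Algebra.Lattice.Bundles using (BooleanAlgebra)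
import Algebra.Lattice.Properties.BooleanAlgebra as BAProps
import Algebra.Lattice.Properties.Lattice as LProps
import Relation.Binary.Reasoning.Setoid as SetoidReasoning

-- Finite
-- non-empty subsets Γ ∈ 𝒫_fin A are represented by non-empty lists.

module TangledDefs {c ℓ : Level} {A : Set c} (_≈_ : Rel A ℓ)
  (_∨_ _∧_ : Op₂ A) (-_ : Op₁ A) (⊤ ⊥ : A) where

  _≤_ : A → A → Set ℓ
  a ≤ b = (a ∧ b) ≈ a

  _⇒_ : A → A → A
  a ⇒ b = (- a) ∨ b

  ⋀ : List⁺ A → (A → A) → A
  ⋀ Γ f = foldr₁ _∧_ (map⁺ f Γ)

  record IsClosureOperator (C : A → A) : Set (c ⊔ ℓ) where
    field
      C-cong  : ∀ {a b} → a ≈ b → C a ≈ C b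
      C-join  : ∀ a b → C (a ∨ b) ≈ (C a ∨ C b)
      C-bot   : C ⊥ ≈ ⊥
      C-incr  : ∀ a → a ≤ C a
      C-idem  : ∀ a → C a ≈ C (C a)

  module Induced (Ct : List⁺ A → A) where
    C : A → A
    C a = Ct [ a ]

    I : A → A
    I a = - (C (- a))

  record IsTangledClosureAlgebra (Ct : List⁺ A → A) : Set (c ⊔ ℓ) where
    open Induced Ct
    field
      Ct-cong : ∀ {Γ Δ} → Pointwise _≈_ (toList Γ) (toList Δ) → Ct Γ ≈ Ct Δ
      isClosure : IsClosureOperator C
      Fix : ∀ (Γ : List⁺ A) → Ct Γ ≤ ⋀ Γ (λ γ → C (γ ∧ Ct Γ))
      Ind : ∀ (Γ : List⁺ A) (a : A) →
            (I (a ⇒ ⋀ Γ (λ γ → C (γ ∧ a))) ∧ a) ≤ Ct Γ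

module _ {c ℓ : Level} (B : BooleanAlgebra c ℓ) where
  open BooleanAlgebra B renaming (Carrier to A; ¬_ to -_)
  open SetoidReasoning setoid
  open BAProps B using (∧-zeroˡ)
  open LProps lattice using (∧-idem)

  open TangledDefs _≈_ _∨_ _∧_ -_ ⊤ ⊥ public using ()
  private
    module T = TangledDefs _≈_ _∨_ _∧_ -_ ⊤ ⊥

  IsTCA : (List⁺ A → A) → Set (c ⊔ ℓ)
  IsTCA = T.IsTangledClosureAlgebra

  CA : (List⁺ A → A) → A → A
  CA = T.Induced.C

  IA : (List⁺ A → A) → A → A
  IA = T.Induced.I

  Open : (List⁺ A → A) → A → Set ℓ
  Open Ct α = IA Ct α ≈ α

  module Relativise (α : A) where
    Aα : Set (c ⊔ ℓ)
    Aα = Σ A (λ b → b T.≤ α)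

    private
      αx≤α : ∀ x → (α ∧ x) T.≤ α
      αx≤α x = begin
        (α ∧ x) ∧ α ≈⟨ ∧-assoc α x α ⟩
        α ∧ (x ∧ α) ≈⟨ ∧-congˡ (∧-comm x α) ⟩
        α ∧ (α ∧ x) ≈⟨ ∧-assoc α α x ⟨
        (α ∧ α) ∧ x ≈⟨ ∧-congʳ (∧-idem α) ⟩
        α ∧ x ∎

    _≈α_ : Rel Aα ℓ
    x ≈α y = proj₁ x ≈ proj₁ y

    _∧α_ : Op₂ Aα
    (a , p) ∧α (b , q) = (a ∧ b) , (begin
      (a ∧ b) ∧ α ≈⟨ ∧-assoc a b α ⟩
      a ∧ (b ∧ α) ≈⟨ ∧-congˡ q ⟩
      a ∧ b ∎)

    _∨α_ : Op₂ Aα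
    (a , p) ∨α (b , q) = (a ∨ b) , (begin
      (a ∨ b) ∧ α ≈⟨ ∧-distribʳ-∨ α a b ⟩
      (a ∧ α) ∨ (b ∧ α) ≈⟨ ∨-cong p q ⟩
      a ∨ b ∎)

    -α_ : Op₁ Aα
    -α (b , _) = (α ∧ (- b)) , αx≤α (- b)

    ⊤α : Aα
    ⊤α = α , (begin
      α ∧ α ≈⟨ ∧-idem α ⟩
      α ∎)

    ⊥α : Aα
    ⊥α = ⊥ , ∧-zeroˡ α

    Ctα : (List⁺ A → A) → List⁺ Aα → Aα
    Ctα Ct Γ = (α ∧ Ct (map⁺ proj₁ Γ)) , αx≤α _

    Cα : (List⁺ A → A) → Aα → Aα
    Cα Ct (b , _) = (α ∧ CA Ct b) , αx≤α _

    module TR = TangledDefs _≈α_ _∨α_ _∧α_ -α_ ⊤α ⊥α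

-- Openness of α means that - α is closed, and then x ≤ - α ∨ (α ∧ x) gives the
-- inequality α ∧ C x ≤ C (α ∧ x) on which everything rests.  It makes C_α
-- idempotent, transports the fixed-point axiom by meeting with α, and bounds
-- the relative interior α ∧ - C_α (α ∧ - x) by the interior - C (- x), so that
-- the induction axiom of A_α is an instance of the one in A.
module Submission where

open import Defs
open import Level using (Level)
open import Data.Product using (_×_; _,_; proj₁)
open import Data.List using ([]; _∷_)
open import Data.List.NonEmpty using (List⁺; _∷_) renaming (map to map⁺)
import Data.List.Relation.Binary.Pointwise as Pointwise
open import Algebra.Bundles using (CommutativeSemiring)
open import Algebra.Lattice.Bundles using (BooleanAlgebra)
import Algebra.Lattice.Properties.BooleanAlgebra as BooleanAlgebraProperties
import Algebra.Lattice.Properties.Lattice as LatticeProperties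
import Algebra.Properties.CommutativeSemigroup as CommutativeSemigroupProperties
import Relation.Binary.Lattice.Bundles as OrderTheoretic
import Relation.Binary.Lattice.Properties.MeetSemilattice as MeetSemilatticeProperties
import Relation.Binary.Lattice.Properties.JoinSemilattice as JoinSemilatticeProperties
import Relation.Binary.Reasoning.PartialOrder as PartialOrderReasoning
import Relation.Binary.PropositionalEquality as ≡

module _ {c ℓ : Level} (B : BooleanAlgebra c ℓ) where

  open BooleanAlgebra B renaming (Carrier to A; ¬_ to -_)
  open BooleanAlgebraProperties B
    using (∧-identityˡ; ∨-identityˡ; ∧-zeroʳ; ¬-involutive; deMorgan₁; deMorgan₂; ∨-∧-commutativeSemiring)
  open CommutativeSemigroupProperties
    (CommutativeSemiring.*-commutativeSemigroup ∨-∧-commutativeSemiring)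
    using (x∙yz≈y∙xz)
  open OrderTheoretic.Lattice (LatticeProperties.∨-∧-orderTheoreticLattice lattice)
    using (_≤_; poset; meetSemilattice; joinSemilattice; x∧y≤x; x∧y≤y; ∧-greatest; x≤x∨y; y≤x∨y)
    renaming (refl to ≤-refl; trans to ≤-trans; antisym to ≤-antisym)
  open MeetSemilatticeProperties meetSemilattice using (∧-monotonic)
  open JoinSemilatticeProperties joinSemilattice using (∨-monotonic; x≤y⇒x∨y≈y)
  open PartialOrderReasoning poset

  private
    module T = TangledDefs _≈_ _∨_ _∧_ -_ ⊤ ⊥
  open T using (_⇒_; ⋀; IsClosureOperator; IsTangledClosureAlgebra)
    renaming (_≤_ to _≤ᵃ_)

  private
    variable
      x y z : A

  -- The tangled closure axioms use the order a ∧ b ≈ a, the library's lattice uses a ≈ a ∧ b.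
  ≤ᵃ⇒≤ : x ≤ᵃ y → x ≤ y
  ≤ᵃ⇒≤ = sym

  ≤⇒≤ᵃ : x ≤ y → x ≤ᵃ y
  ≤⇒≤ᵃ = sym

  ¬-antitone : x ≤ y → - y ≤ - x
  ¬-antitone {x} {y} x≤y = begin
    - y         ≤⟨ y≤x∨y (- x) (- y) ⟩
    - x ∨ - y   ≈⟨ deMorgan₁ x y ⟨
    - (x ∧ y)   ≈⟨ ¬-cong x≤y ⟨
    - x         ∎

  ¬-⇒ : ∀ x y → - (x ⇒ y) ≈ x ∧ - y
  ¬-⇒ x y = trans (deMorgan₂ (- x) y) (∧-congʳ (¬-involutive x))

  ⇒-curry : y ∧ x ≤ z → x ≤ y ⇒ z
  ⇒-curry {y} {x} {z} y∧x≤z = begin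
    x                    ≈⟨ ∧-identityˡ x ⟨
    ⊤ ∧ x                ≈⟨ ∧-congʳ (∨-complementˡ y) ⟨
    (- y ∨ y) ∧ x        ≈⟨ ∧-distribʳ-∨ x (- y) y ⟩
    (- y ∧ x) ∨ (y ∧ x)  ≤⟨ ∨-monotonic (x∧y≤x (- y) x) y∧x≤z ⟩
    - y ∨ z              ∎

  ⇒-uncurry : x ≤ y ⇒ z → y ∧ x ≤ z
  ⇒-uncurry {x} {y} {z} x≤y⇒z = begin
    y ∧ x                ≤⟨ ∧-monotonic ≤-refl x≤y⇒z ⟩
    y ∧ (- y ∨ z)        ≈⟨ ∧-distribˡ-∨ y (- y) z ⟩
    (y ∧ - y) ∨ (y ∧ z)  ≈⟨ ∨-congʳ (∧-complementʳ y) ⟩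
    ⊥ ∨ (y ∧ z)          ≈⟨ ∨-identityˡ (y ∧ z) ⟩
    y ∧ z                ≤⟨ x∧y≤y y z ⟩
    z                    ∎

  ⋀-mono : ∀ (Γ : List⁺ A) {f g : A → A} → (∀ x → f x ≤ g x) → ⋀ Γ f ≤ ⋀ Γ g
  ⋀-mono (x ∷ xs) {f} {g} f≤g = go x xs
    where
    go : ∀ x xs → ⋀ (x ∷ xs) f ≤ ⋀ (x ∷ xs) g
    go x []       = f≤g x
    go x (y ∷ ys) = ∧-monotonic (f≤g x) (go y ys)

  ∧-⋀-≤ : ∀ z (Γ : List⁺ A) (f : A → A) → z ∧ ⋀ Γ f ≤ ⋀ Γ (λ x → z ∧ f x)
  ∧-⋀-≤ z (x ∷ xs) f = go x xs
    where
    go : ∀ x xs → z ∧ ⋀ (x ∷ xs) f ≤ ⋀ (x ∷ xs) (λ w → z ∧ f w)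
    go x []       = ≤-refl
    go x (y ∷ ys) = ∧-greatest
      (∧-monotonic ≤-refl (x∧y≤x (f x) _))
      (≤-trans (∧-monotonic ≤-refl (x∧y≤y (f x) _)) (go y ys))

  module ClosureProperties {C : A → A} (isClosure : IsClosureOperator C) where

    open IsClosureOperator isClosure

    C-mono : x ≤ y → C x ≤ C y
    C-mono {x} {y} x≤y = begin
      C x        ≤⟨ x≤x∨y (C x) (C y) ⟩
      C x ∨ C y  ≈⟨ C-join x y ⟨
      C (x ∨ y)  ≈⟨ C-cong (x≤y⇒x∨y≈y x≤y) ⟩
      C y        ∎

    interior-mono : x ≤ y → - C (- x) ≤ - C (- y)
    interior-mono x≤y = ¬-antitone (C-mono (¬-antitone x≤y))

    module _ (α : A) (closed-complement : C (- α) ≈ - α) where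

      ∧-C≤C-∧ : ∀ x → α ∧ C x ≤ C (α ∧ x)
      ∧-C≤C-∧ x = ⇒-uncurry (begin
        C x                  ≤⟨ C-mono (⇒-curry ≤-refl) ⟩
        C (α ⇒ (α ∧ x))      ≈⟨ C-join (- α) (α ∧ x) ⟩
        C (- α) ∨ C (α ∧ x)  ≈⟨ ∨-congʳ closed-complement ⟩
        α ⇒ C (α ∧ x)        ∎)

      ∧-C-∧-C : ∀ x → α ∧ C (α ∧ C x) ≈ α ∧ C x
      ∧-C-∧-C x = ≤-antisym
        (begin
          α ∧ C (α ∧ C x)  ≤⟨ ∧-monotonic ≤-refl (C-mono (x∧y≤y α (C x))) ⟩
          α ∧ C (C x)      ≈⟨ ∧-congˡ (C-idem x) ⟨
          α ∧ C x          ∎)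
        (∧-greatest (x∧y≤x α (C x)) (begin
          α ∧ C x          ≈⟨ ∧-congˡ (C-idem x) ⟩
          α ∧ C (C x)      ≤⟨ ∧-C≤C-∧ (C x) ⟩
          C (α ∧ C x)      ∎))

      relative-interior≤interior : ∀ x → α ∧ - (α ∧ C (α ∧ - x)) ≤ - C (- x)
      relative-interior≤interior x = begin
        α ∧ - (α ∧ C (α ∧ - x))    ≈⟨ ¬-⇒ α (α ∧ C (α ∧ - x)) ⟨
        - (α ⇒ (α ∧ C (α ∧ - x)))  ≤⟨ ¬-antitone (⇒-curry (∧-greatest (x∧y≤x α _) (∧-C≤C-∧ (- x)))) ⟩
        - C (- x)                  ∎

  module Relativisation (Ct : List⁺ A → A) (tca : IsTCA B Ct) (α : A) (α-open : Open B Ct α) where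

    open IsTangledClosureAlgebra tca
    open IsClosureOperator isClosure
    open T.Induced Ct using (C; I)
    open ClosureProperties isClosure
    open Relativise B α
    module Relative = TR.Induced (Ctα Ct)

    C-closed-complement : C (- α) ≈ - α
    C-closed-complement = trans (sym (¬-involutive (C (- α)))) (¬-cong α-open)

    proj₁-⋀-C : ∀ (Γ : List⁺ Aα) (b : Aα) →
                proj₁ (TR.⋀ Γ (λ γ → Relative.C (γ ∧α b))) ≡.≡ ⋀ (map⁺ proj₁ Γ) (λ g → α ∧ C (g ∧ proj₁ b))
    proj₁-⋀-C (x ∷ xs) b = go x xs
      where
      go : ∀ x xs → proj₁ (TR.⋀ (x ∷ xs) (λ γ → Relative.C (γ ∧α b)))
                    ≡.≡ ⋀ (map⁺ proj₁ (x ∷ xs)) (λ g → α ∧ C (g ∧ proj₁ b))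
      go x []       = ≡.refl
      go x (y ∷ ys) = ≡.cong ((α ∧ C (proj₁ x ∧ proj₁ b)) ∧_) (go y ys)

    isClosureᵅ : TR.IsClosureOperator Relative.C
    isClosureᵅ = record
      { C-cong = λ a≈b → ∧-congˡ (C-cong a≈b)
      ; C-join = λ a b → trans (∧-congˡ (C-join (proj₁ a) (proj₁ b))) (∧-distribˡ-∨ α _ _)
      ; C-bot  = trans (∧-congˡ C-bot) (∧-zeroʳ α)
      ; C-incr = λ { (a , a≤α) → ≤⇒≤ᵃ (∧-greatest (≤ᵃ⇒≤ a≤α) (≤ᵃ⇒≤ (C-incr a))) }
      ; C-idem = λ { (a , _) → sym (∧-C-∧-C α C-closed-complement a) }
      }

    Fixᵅ : ∀ Γ → Ctα Ct Γ TR.≤ TR.⋀ Γ (λ γ → Relative.C (γ ∧α Ctα Ct Γ))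
    Fixᵅ Γ = ≤⇒≤ᵃ (begin
      α ∧ t                            ≤⟨ ∧-monotonic ≤-refl (≤ᵃ⇒≤ (Fix G)) ⟩
      α ∧ ⋀ G (λ g → C (g ∧ t))        ≤⟨ ∧-⋀-≤ α G _ ⟩
      ⋀ G (λ g → α ∧ C (g ∧ t))        ≤⟨ ⋀-mono G meet-inside ⟩
      ⋀ G (λ g → α ∧ C (g ∧ (α ∧ t)))  ≡⟨ proj₁-⋀-C Γ (Ctα Ct Γ) ⟨
      proj₁ (TR.⋀ Γ (λ γ → Relative.C (γ ∧α Ctα Ct Γ))) ∎)
      where
      G : List⁺ A
      G = map⁺ proj₁ Γ
      t : A
      t = Ct G
      meet-inside : ∀ g → α ∧ C (g ∧ t) ≤ α ∧ C (g ∧ (α ∧ t))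
      meet-inside g = ∧-greatest (x∧y≤x α _) (begin
        α ∧ C (g ∧ t)    ≤⟨ ∧-C≤C-∧ α C-closed-complement (g ∧ t) ⟩
        C (α ∧ (g ∧ t))  ≈⟨ C-cong (x∙yz≈y∙xz α g t) ⟩
        C (g ∧ (α ∧ t))  ∎)

    Indᵅ : ∀ Γ a → (Relative.I (a TR.⇒ TR.⋀ Γ (λ γ → Relative.C (γ ∧α a))) ∧α a) TR.≤ Ctα Ct Γ
    Indᵅ Γ a@(a₀ , a₀≤α) = ≤⇒≤ᵃ (∧-greatest
      (≤-trans (x∧y≤y _ a₀) (≤ᵃ⇒≤ a₀≤α))
      (begin
        proj₁ (Relative.I premise) ∧ a₀  ≤⟨ ∧-monotonic interior-bound ≤-refl ⟩
        I (a₀ ⇒ m) ∧ a₀      ≤⟨ ≤ᵃ⇒≤ (Ind G a₀) ⟩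
        Ct G                 ∎))
      where
      G : List⁺ A
      G = map⁺ proj₁ Γ
      m : A
      m = ⋀ G (λ g → C (g ∧ a₀))
      premise : Aα
      premise = a TR.⇒ TR.⋀ Γ (λ γ → Relative.C (γ ∧α a))
      relative-meet≤meet : proj₁ (TR.⋀ Γ (λ γ → Relative.C (γ ∧α a))) ≤ m
      relative-meet≤meet = begin
        proj₁ (TR.⋀ Γ (λ γ → Relative.C (γ ∧α a)))  ≡⟨ proj₁-⋀-C Γ a ⟩
        ⋀ G (λ g → α ∧ C (g ∧ a₀))            ≤⟨ ⋀-mono G (λ g → x∧y≤y α _) ⟩
        m                                     ∎
      interior-bound : proj₁ (Relative.I premise) ≤ I (a₀ ⇒ m)
      interior-bound = begin
        proj₁ (Relative.I premise)  ≤⟨ relative-interior≤interior α C-closed-complement (proj₁ premise) ⟩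
        I (proj₁ premise)     ≤⟨ interior-mono (∨-monotonic (x∧y≤y α (- a₀)) relative-meet≤meet) ⟩
        I (a₀ ⇒ m)      ∎

    isTCAᵅ : TR.IsTangledClosureAlgebra (Ctα Ct)
    isTCAᵅ = record
      { Ct-cong   = λ Γ≈Δ → ∧-congˡ (Ct-cong (Pointwise.map⁺ proj₁ proj₁ Γ≈Δ))
      ; isClosure = isClosureᵅ
      ; Fix       = Fixᵅ
      ; Ind       = Indᵅ
      }

theorem3p3 : ∀ {c ℓ} (B : BooleanAlgebra c ℓ) (Ct : List⁺ (BooleanAlgebra.Carrier B) → BooleanAlgebra.Carrier B) → IsTCA B Ct → (α : BooleanAlgebra.Carrier B) → Open B Ct α → TangledDefs.IsTangledClosureAlgebra (Relativise._≈α_ B α) (Relativise._∨α_ B α) (Relativise._∧α_ B α) (Relativise.-α_ B α) (Relativise.⊤α B α) (Relativise.⊥α B α) (Relativise.Ctα B α Ct) × (∀ b → Relativise._≈α_ B α (TangledDefs.Induced.C (Relativise._≈α_ B α) (Relativise._∨α_ B α) (Relativise._∧α_ B α) (Relativise.-α_ B α) (Relativise.⊤α B α) (Relativise.⊥α B α) (Relativise.Ctα B α Ct) b) (Relativise.Cα B α Ct b))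
theorem3p3 B Ct tca α α-open = Relativisation.isTCAᵅ B Ct tca α α-open , λ _ → BooleanAlgebra.refl B
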